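{- Let $S$ be a finite nonempty semigroup and consider its subsemigroup complex ${\cal H}(S)$. For all $s,t\in S$, $\overline{\{s\}}=\overline{\{t\}}$ if and only if $s^+=t^+$.
   Context: For a finite nonempty semigroup $S$ and $Y\subseteq S$, $Y^+$ denotes the subsemigroup generated by $Y$ ($\emptyset^+=\emptyset$), and $s^+=\{s\}^+$. The subsemigroup complex ${\cal H}(S)=(S,H(S))$ is the simplicial complex with vertex set $S$ whose faces are the subsets $X\subseteq S$ admitting an enumeration $x_1,\dots,x_k$ with $\emptyset\subset\{x_1\}^+\subset\{x_1,x_2\}^+\subset\cdots\subset\{x_1,\dots,x_k\}^+$ (all inclusions strict). For a simplicial complex $(A,H)$, a subset $X\subseteq A$ is a flat if for every face $I\in H$ with $I\subseteq X$ and every $p\in A\setminus X$ we have $I\cup\{p\}\in H$; the closure $\overline{X}$ of $X\subseteq A$ is the intersection of all flats containing $X$. -}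

module Defs where

open import Level using (0ℓ)
open import Data.Nat using (ℕ; suc)
open import Data.Fin using (Fin)
open import Data.Fin.Subset using (Subset; _∈_; _∉_; _⊆_; _∪_; ⁅_⁆)
open import Data.List using (List; []; _∷_; take; length)
open import Data.List.Membership.Propositional using () renaming (_∈_ to _∈ₗ_)
open import Data.List.Relation.Unary.Unique.Propositional using (Unique)
open import Data.Product using (Σ; ∃; _×_; ∃-syntax)
open import Data.Unit using (⊤)
open import Relation.Nullary using (¬_)
open import Function.Bundles using (_⇔_)
open import Algebra.Core using (Op₂)

-- A finite semigroup is represented (up to isomorphism) by an
-- associative binary operation on Fin n.
module Complex {n : ℕ} (_∙_ : Op₂ (Fin n)) where

  -- Y⁺ : the subsemigroup generated by a set Y (smallest subset
  -- containing Y and closed under _∙_); note ∅⁺ = ∅.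
  data Gen (Y : Fin n → Set) : Fin n → Set where
    base : ∀ {x} → Y x → Gen Y x
    mul  : ∀ {x y} → Gen Y x → Gen Y y → Gen Y (x ∙ y)

  _⁺ : Subset n → Fin n → Set
  Y ⁺ = Gen (_∈ Y)

  ⟨_⟩⁺ : List (Fin n) → Fin n → Set
  ⟨ xs ⟩⁺ = Gen (_∈ₗ xs)

  _⊂ₚ_ : (Fin n → Set) → (Fin n → Set) → Set
  A ⊂ₚ B = (∀ z → A z → B z) × (∃[ z ] (B z × ¬ A z))

  -- ∅ ⊂ {x₁}⁺ ⊂ {x₁,x₂}⁺ ⊂ ⋯ ⊂ {x₁,…,x_k}⁺ : for every i < k,
  -- {x₁,…,x_i}⁺ ⊂ {x₁,…,x_{i+1}}⁺ (the i = 0 case is ∅ ⊂ {x₁}⁺).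
  StrictChain : List (Fin n) → Set
  StrictChain xs = ∀ (i : ℕ) → suc i Data.Nat.≤ length xs →
                   ⟨ take i xs ⟩⁺ ⊂ₚ ⟨ take (suc i) xs ⟩⁺

  Face : Subset n → Set
  Face X = ∃[ xs ] (Unique xs × (∀ x → (x ∈ X) ⇔ (x ∈ₗ xs)) × StrictChain xs)

  Flat : Subset n → Set
  Flat F = ∀ (I : Subset n) → Face I → I ⊆ F →
           ∀ (p : Fin n) → p ∉ F → Face (I ∪ ⁅ p ⁆)

  Cl : Subset n → Fin n → Set
  Cl X p = ∀ (F : Subset n) → Flat F → X ⊆ F → p ∈ F

  _≐_ : (Fin n → Set) → (Fin n → Set) → Set
  A ≐ B = ∀ z → A z ⇔ B z

module Submission where

-- Both directions reduce to the statement "t ∈ s⁺ and s ∈ t⁺".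
--
-- (⇒) Every subsemigroup G of S is a flat: a face I ⊆ G has I⁺ ⊆ G, so a
--     vertex p ∉ G is not generated by I and may be appended to any
--     enumeration of I without breaking strictness of its chain.  In a
--     finite semigroup s⁺ = {s, s², …, s^(|S|+1)} is a decidable set, hence
--     a subset of S and thus a flat containing s; so cl{s} ⊆ s⁺, and
--     t ∈ cl{t} = cl{s} gives t ∈ s⁺ (symmetrically s ∈ t⁺).
-- (⇐) If s ≠ t generate each other, {s,t} is not a face: whichever of
--     them is enumerated first already generates the second.  So a flat F
--     containing s must contain t (otherwise flatness applied to the face
--     {s} and the vertex t would make {s,t} a face), whence cl{t} ⊆ cl{s}.
--
-- Only the finiteness argument for s⁺ uses associativity; all facts about
-- faces, flats and closures hold for an arbitrary binary operation.

open import Defs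
open import Data.Nat using (ℕ; suc)
open import Data.Fin using (Fin)
open import Data.Fin.Subset using (⁅_⁆)
open import Algebra.Core using (Op₂)
open import Algebra.Structures using (IsSemigroup)
open import Relation.Binary.PropositionalEquality using (_≡_)
open import Function.Bundles using (_⇔_)

open import Data.Nat using (zero; _+_; _<_; _≤_; z≤n; s≤s; s<s; _≤?_)
open import Data.Nat.Properties
  using (n<1+n; +-suc; +-identityʳ; +-monoˡ-<; ≤-refl; ≤-trans; ≤-pred; ≤-reflexive;
         <⇒≤; ≰⇒>; m≤n⇒m<n∨m≡n; m≤n⇒∃[o]m+o≡n)
open import Data.Nat.Induction using (<-rec)
open import Data.Fin using (toℕ; fromℕ<)
open import Data.Fin.Properties using (_≟_; any?; pigeonhole; toℕ<n; toℕ-fromℕ<)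
open import Data.Fin.Subset using (Subset; _∈_; _⊆_; _∪_)
open import Data.Fin.Subset.Properties using (x∈⁅x⁆; x∈⁅y⁆⇒x≡y; x∈⁅y⁆⇔x≡y; ∪⇔⊎; _∈?_)
open import Data.Vec using (tabulate)
open import Data.Vec.Properties using (lookup∘tabulate; []=⇒lookup; lookup⇒[]=)
open import Data.List using (List; []; _∷_; _++_; take; length)
open import Data.List.Properties using (take-all)
open import Data.List.Membership.Propositional using () renaming (_∈_ to _∈ₗ_)
open import Data.List.Membership.Propositional.Properties using (∈-++⁺ˡ; ∈-++⁺ʳ; ∈-++⁻)
open import Data.List.Relation.Unary.Any using (here; there)
open import Data.List.Relation.Unary.All using ([])
open import Data.List.Relation.Unary.AllPairs using ([]; _∷_)
open import Data.List.Relation.Unary.Unique.Propositional using (Unique)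
open import Data.List.Relation.Unary.Unique.Propositional.Properties using (++⁺)
open import Data.Product using (Σ; ∃-syntax; _×_; _,_; proj₁; proj₂)
open import Data.Sum using (_⊎_; inj₁; inj₂; [_,_])
open import Data.Sum.Function.Propositional using (_⊎-⇔_)
open import Data.Bool.Properties using (T-≡)
open import Data.Empty using (⊥; ⊥-elim)
open import Function using (_∘_)
open import Function.Bundles using (mk⇔; Equivalence)
import Function.Properties.Equivalence as ⇔
open import Algebra.Definitions using (Associative)
open import Relation.Unary using (Pred; Decidable)
open import Relation.Nullary using (¬_; yes; no)
open import Relation.Nullary.Decidable using (⌊_⌋; toWitness; fromWitness)
import Relation.Nullary.Decidable as Dec
open import Relation.Binary.PropositionalEquality using (refl; sym; trans; cong; subst; _≢_; module ≡-Reasoning)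

open Equivalence using (to; from)

take-++ˡ : ∀ {A : Set} i (xs ys : List A) → i ≤ length xs → take i (xs ++ ys) ≡ take i xs
take-++ˡ zero    xs       ys _         = refl
take-++ˡ (suc i) (x ∷ xs) ys (s≤s i≤) = cong (x ∷_) (take-++ˡ i xs ys i≤)

length-snoc : ∀ {A : Set} (xs : List A) y → length (xs ++ y ∷ []) ≡ suc (length xs)
length-snoc []       y = refl
length-snoc (x ∷ xs) y = cong suc (length-snoc xs y)

subset-of : ∀ {m ℓ} {P : Pred (Fin m) ℓ} → Decidable P →
            Σ (Subset m) λ X → ∀ x → x ∈ X ⇔ P x
subset-of {m} {P = P} P? = X , λ x → mk⇔ (∈X⇒P x) (P⇒∈X x)
  where
  X : Subset m
  X = tabulate (⌊_⌋ ∘ P?)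
  ∈X⇒P : ∀ x → x ∈ X → P x
  ∈X⇒P x x∈X = toWitness (from T-≡ (trans (sym (lookup∘tabulate (⌊_⌋ ∘ P?) x)) ([]=⇒lookup x∈X)))
  P⇒∈X : ∀ x → P x → x ∈ X
  P⇒∈X x px = lookup⇒[]= x X (trans (lookup∘tabulate (⌊_⌋ ∘ P?) x) (to T-≡ (fromWitness px)))

⁅⁆⊆ : ∀ {m} {s : Fin m} {F : Subset m} → s ∈ F → ⁅ s ⁆ ⊆ F
⁅⁆⊆ {s = s} {F} s∈F x∈⁅s⁆ = subst (_∈ F) (sym (x∈⁅y⁆⇒x≡y s x∈⁅s⁆)) s∈F

module Magma {m : ℕ} (_∙_ : Op₂ (Fin m)) where
  open Complex _∙_

  Gen-⊆ : ∀ {A B : Fin m → Set} → (∀ x → A x → Gen B x) → ∀ {y} → Gen A y → Gen B y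
  Gen-⊆ A⊆B⁺ (base a)  = A⊆B⁺ _ a
  Gen-⊆ A⊆B⁺ (mul g h) = mul (Gen-⊆ A⊆B⁺ g) (Gen-⊆ A⊆B⁺ h)

  Gen-least : ∀ {A P : Fin m → Set} → (∀ x → A x → P x) →
              (∀ x y → P x → P y → P (x ∙ y)) → ∀ {y} → Gen A y → P y
  Gen-least A⊆P closed (base a)  = A⊆P _ a
  Gen-least A⊆P closed (mul g h) = closed _ _ (Gen-least A⊆P closed g) (Gen-least A⊆P closed h)

  Gen-∅ : ∀ {y} → ¬ ⟨ [] ⟩⁺ y
  Gen-∅ (base ())
  Gen-∅ (mul g _) = Gen-∅ g

  ⁺-self : ∀ s → (⁅ s ⁆ ⁺) s
  ⁺-self s = base (x∈⁅x⁆ s)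

  ⁺-trans : ∀ {s t} → (⁅ s ⁆ ⁺) t → ∀ {z} → (⁅ t ⁆ ⁺) z → (⁅ s ⁆ ⁺) z
  ⁺-trans {s} {t} t∈s⁺ = Gen-⊆ (λ x x∈⁅t⁆ → subst (⁅ s ⁆ ⁺) (sym (x∈⁅y⁆⇒x≡y t x∈⁅t⁆)) t∈s⁺)

  ⁺-≐ : ∀ {s t} → (⁅ s ⁆ ⁺) t → (⁅ t ⁆ ⁺) s → (⁅ s ⁆ ⁺) ≐ (⁅ t ⁆ ⁺)
  ⁺-≐ t∈s⁺ s∈t⁺ z = mk⇔ (⁺-trans s∈t⁺) (⁺-trans t∈s⁺)

  ⟨⟩⁺⇒⁺ : ∀ {I : Subset m} {xs} → (∀ x → (x ∈ I) ⇔ (x ∈ₗ xs)) → ∀ {y} → ⟨ xs ⟩⁺ y → (I ⁺) y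
  ⟨⟩⁺⇒⁺ I⇔xs = Gen-⊆ (λ x x∈xs → base (from (I⇔xs x) x∈xs))

  ⁺⇒⟨⟩⁺ : ∀ {s y} → (⁅ s ⁆ ⁺) y → ⟨ s ∷ [] ⟩⁺ y
  ⁺⇒⟨⟩⁺ {s} = Gen-⊆ (λ x x∈⁅s⁆ → base (here (x∈⁅y⁆⇒x≡y s x∈⁅s⁆)))

  chain-second-new : ∀ {x y ys} → StrictChain (x ∷ y ∷ ys) → ¬ ⟨ x ∷ [] ⟩⁺ y
  chain-second-new {x} {y} chain y∈⟨x⟩⁺ =
    let (_ , z , z∈⟨xy⟩⁺ , z∉⟨x⟩⁺) = chain 1 (s≤s (s≤s z≤n))
    in z∉⟨x⟩⁺ (Gen-⊆ generated-by-x z∈⟨xy⟩⁺)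
    where
    generated-by-x : ∀ w → w ∈ₗ x ∷ y ∷ [] → ⟨ x ∷ [] ⟩⁺ w
    generated-by-x _ (here refl)         = base (here refl)
    generated-by-x _ (there (here refl)) = y∈⟨x⟩⁺

  chain-snoc : ∀ {xs p} → StrictChain xs → ¬ ⟨ xs ⟩⁺ p → StrictChain (xs ++ p ∷ [])
  chain-snoc {xs} {p} chain p∉⟨xs⟩⁺ i i<∣xsp∣
    with m≤n⇒m<n∨m≡n (≤-pred (subst (suc i ≤_) (length-snoc xs p) i<∣xsp∣))
  ... | inj₁ i<∣xs∣
    rewrite take-++ˡ i xs (p ∷ []) (<⇒≤ i<∣xs∣) | take-++ˡ (suc i) xs (p ∷ []) i<∣xs∣
    = chain i i<∣xs∣
  ... | inj₂ refl
    rewrite take-++ˡ (length xs) xs (p ∷ []) ≤-refl | take-all (length xs) xs ≤-refl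
          | take-all (suc (length xs)) (xs ++ p ∷ []) (≤-reflexive (length-snoc xs p))
    = (λ _ → Gen-⊆ (λ _ x∈xs → base (∈-++⁺ˡ x∈xs))) , p , base (∈-++⁺ʳ xs (here refl)) , p∉⟨xs⟩⁺

  face-extend : ∀ {I p} → Face I → ¬ (I ⁺) p → Face (I ∪ ⁅ p ⁆)
  face-extend {I} {p} (xs , unique , I⇔xs , chain) p∉I⁺ =
    xs ++ p ∷ [] , unique′ , members , chain-snoc chain (p∉I⁺ ∘ ⟨⟩⁺⇒⁺ I⇔xs)
    where
    unique′ : Unique (xs ++ p ∷ [])
    unique′ = ++⁺ unique ([] ∷ []) λ { (p∈xs , here refl) → p∉I⁺ (base (from (I⇔xs p) p∈xs)) }
    ⁅p⁆⇔[p] : ∀ x → (x ∈ ⁅ p ⁆) ⇔ (x ∈ₗ p ∷ [])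
    ⁅p⁆⇔[p] x = ⇔.trans x∈⁅y⁆⇔x≡y (mk⇔ here λ { (here x≡p) → x≡p ; (there ()) })
    ++⇔⊎ : ∀ x → (x ∈ₗ xs ⊎ x ∈ₗ p ∷ []) ⇔ (x ∈ₗ xs ++ p ∷ [])
    ++⇔⊎ x = mk⇔ [ ∈-++⁺ˡ , ∈-++⁺ʳ xs ] (∈-++⁻ xs)
    members : ∀ x → (x ∈ I ∪ ⁅ p ⁆) ⇔ (x ∈ₗ xs ++ p ∷ [])
    members x = ⇔.trans ∪⇔⊎ (⇔.trans (I⇔xs x ⊎-⇔ ⁅p⁆⇔[p] x) (++⇔⊎ x))

  closed⇒flat : ∀ (G : Subset m) → (∀ x y → x ∈ G → y ∈ G → (x ∙ y) ∈ G) → Flat G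
  closed⇒flat G closed I face I⊆G p p∉G = face-extend face (p∉G ∘ Gen-least (λ _ → I⊆G) closed)

  -- If s⁺ is decidable it is a flat containing s, so cl{s} ⊆ s⁺.
  Cl⊆⁺ : ∀ {s} → Decidable (⁅ s ⁆ ⁺) → ∀ {t} → Cl ⁅ s ⁆ t → (⁅ s ⁆ ⁺) t
  Cl⊆⁺ {s} s⁺? {t} t∈cl = to (G⇔s⁺ t) (t∈cl G (closed⇒flat G closed) (⁅⁆⊆ (from (G⇔s⁺ s) (⁺-self s))))
    where
    G : Subset m
    G = proj₁ (subset-of s⁺?)
    G⇔s⁺ : ∀ x → x ∈ G ⇔ (⁅ s ⁆ ⁺) x
    G⇔s⁺ = proj₂ (subset-of s⁺?)
    closed : ∀ x y → x ∈ G → y ∈ G → (x ∙ y) ∈ G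
    closed x y x∈G y∈G = from (G⇔s⁺ (x ∙ y)) (mul (to (G⇔s⁺ x) x∈G) (to (G⇔s⁺ y) y∈G))

  singleton-face : ∀ s → Face ⁅ s ⁆
  singleton-face s = s ∷ [] , [] ∷ [] , members , chain
    where
    members : ∀ x → (x ∈ ⁅ s ⁆) ⇔ (x ∈ₗ s ∷ [])
    members x = ⇔.trans x∈⁅y⁆⇔x≡y (mk⇔ here λ { (here x≡s) → x≡s ; (there ()) })
    chain : StrictChain (s ∷ [])
    chain zero    _       = (λ _ g → ⊥-elim (Gen-∅ g)) , s , base (here refl) , Gen-∅
    chain (suc i) (s≤s ())

  -- Two distinct elements generating each other do not form a face:
  -- whichever is enumerated first generates the second.
  mutual-pair-not-face : ∀ {s t} → s ≢ t → (⁅ s ⁆ ⁺) t → (⁅ t ⁆ ⁺) s → ¬ Face (⁅ s ⁆ ∪ ⁅ t ⁆)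
  mutual-pair-not-face {s} {t} s≢t t∈s⁺ s∈t⁺ (xs , _ , members , chain) = not-face xs members chain
    where
    pair⇔ : ∀ u → (u ∈ ⁅ s ⁆ ∪ ⁅ t ⁆) ⇔ (u ≡ s ⊎ u ≡ t)
    pair⇔ u = ⇔.trans ∪⇔⊎ (x∈⁅y⁆⇔x≡y ⊎-⇔ x∈⁅y⁆⇔x≡y)
    generates : ∀ {u v} → u ≡ s ⊎ u ≡ t → v ≡ s ⊎ v ≡ t → (⁅ u ⁆ ⁺) v
    generates (inj₁ refl) (inj₁ refl) = ⁺-self s
    generates (inj₁ refl) (inj₂ refl) = t∈s⁺
    generates (inj₂ refl) (inj₁ refl) = s∈t⁺
    generates (inj₂ refl) (inj₂ refl) = ⁺-self t
    not-face : ∀ ys → (∀ u → (u ∈ ⁅ s ⁆ ∪ ⁅ t ⁆) ⇔ (u ∈ₗ ys)) → StrictChain ys → ⊥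
    not-face ys members chain
      with to (members s) (from (pair⇔ s) (inj₁ refl)) | to (members t) (from (pair⇔ t) (inj₂ refl))
    not-face []             _ _ | ()       | _
    not-face (x ∷ [])       _ _ | here s≡x | here t≡x = s≢t (trans s≡x (sym t≡x))
    not-face (x ∷ y ∷ rest) members chain | _ | _ =
      chain-second-new chain (⁺⇒⟨⟩⁺ (generates (in-pair (here refl)) (in-pair (there (here refl)))))
      where
      in-pair : ∀ {u} → u ∈ₗ x ∷ y ∷ rest → u ≡ s ⊎ u ≡ t
      in-pair u∈xs = to (pair⇔ _) (from (members _) u∈xs)

  -- A flat containing s contains every t generating the same subsemigroup;
  -- otherwise flatness applied to the face {s} and the vertex t would make
  -- {s, t} a face.
  flat-mutual : ∀ {s t F} → (⁅ s ⁆ ⁺) t → (⁅ t ⁆ ⁺) s → Flat F → s ∈ F → t ∈ F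
  flat-mutual {s} {t} {F} t∈s⁺ s∈t⁺ flat s∈F with t ∈? F
  ... | yes t∈F = t∈F
  ... | no  t∉F = ⊥-elim (mutual-pair-not-face s≢t t∈s⁺ s∈t⁺
                            (flat ⁅ s ⁆ (singleton-face s) (⁅⁆⊆ s∈F) t t∉F))
    where
    s≢t : s ≢ t
    s≢t refl = t∉F s∈F

  Cl-self : ∀ s → Cl ⁅ s ⁆ s
  Cl-self s F _ ⁅s⁆⊆F = ⁅s⁆⊆F (x∈⁅x⁆ s)

  Cl-⊆ : ∀ {s t} → (∀ F → Flat F → s ∈ F → t ∈ F) → ∀ z → Cl ⁅ t ⁆ z → Cl ⁅ s ⁆ z
  Cl-⊆ {s} s⇒t z z∈cl F flat ⁅s⁆⊆F = z∈cl F flat (⁅⁆⊆ (s⇒t F flat (⁅s⁆⊆F (x∈⁅x⁆ s))))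

  mutual⇒Cl-≐ : ∀ {s t} → (⁅ s ⁆ ⁺) t → (⁅ t ⁆ ⁺) s → Cl ⁅ s ⁆ ≐ Cl ⁅ t ⁆
  mutual⇒Cl-≐ t∈s⁺ s∈t⁺ z =
    mk⇔ (Cl-⊆ (λ _ → flat-mutual s∈t⁺ t∈s⁺) z) (Cl-⊆ (λ _ → flat-mutual t∈s⁺ s∈t⁺) z)

-- In a finite semigroup, s⁺ = {pow 0, …, pow m} where pow k = s^(k+1);
-- in particular membership in s⁺ is decidable.
module Cyclic {m : ℕ} (_∙_ : Op₂ (Fin m)) (assoc : Associative _≡_ _∙_) (s : Fin m) where
  open Complex _∙_
  open ≡-Reasoning

  pow : ℕ → Fin m
  pow zero    = s
  pow (suc k) = pow k ∙ s

  pow-+ : ∀ i j → pow i ∙ pow j ≡ pow (suc (i + j))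
  pow-+ i zero    = cong (pow ∘ suc) (sym (+-identityʳ i))
  pow-+ i (suc j) = begin
    pow i ∙ (pow j ∙ s)      ≡⟨ sym (assoc (pow i) (pow j) s) ⟩
    (pow i ∙ pow j) ∙ s      ≡⟨ cong (_∙ s) (pow-+ i j) ⟩
    pow (suc (suc (i + j)))  ≡⟨ cong (pow ∘ suc) (sym (+-suc i j)) ⟩
    pow (suc (i + suc j))    ∎

  ⁺⇒pow : ∀ {x} → (⁅ s ⁆ ⁺) x → ∃[ k ] x ≡ pow k
  ⁺⇒pow (base x∈⁅s⁆) = 0 , x∈⁅y⁆⇒x≡y s x∈⁅s⁆
  ⁺⇒pow (mul g h) with ⁺⇒pow g | ⁺⇒pow h
  ... | i , refl | j , refl = suc (i + j) , pow-+ i j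

  pow∈⁺ : ∀ k → (⁅ s ⁆ ⁺) (pow k)
  pow∈⁺ zero    = base (x∈⁅x⁆ s)
  pow∈⁺ (suc k) = mul (pow∈⁺ k) (base (x∈⁅x⁆ s))

  repetition : ∃[ a ] ∃[ b ] a < b × b ≤ m × pow a ≡ pow b
  repetition =
    let (i , j , i<j , pi≡pj) = pigeonhole (n<1+n m) (pow ∘ toℕ)
    in toℕ i , toℕ j , i<j , ≤-pred (toℕ<n j) , pi≡pj

  -- Once pow a = pow b with a < b, every exponent k > b can be lowered to
  -- a + (k - b) < k, since pow (b + 1 + d) = pow b ∙ pow d = pow (a + 1 + d).
  reduce-exponent : ∀ {a b} → a < b → pow a ≡ pow b → ∀ k → ∃[ k′ ] k′ ≤ b × pow k ≡ pow k′
  reduce-exponent {a} {b} a<b pa≡pb = <-rec _ reduce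
    where
    reduce : ∀ k → (∀ {j} → j < k → ∃[ k′ ] k′ ≤ b × pow j ≡ pow k′) →
             ∃[ k′ ] k′ ≤ b × pow k ≡ pow k′
    reduce k lower with k ≤? b
    ... | yes k≤b = k , k≤b , refl
    ... | no  k≰b with m≤n⇒∃[o]m+o≡n (≰⇒> k≰b)
    ... | d , refl =
      let (k′ , k′≤b , eq) = lower (s<s (+-monoˡ-< d a<b)) in k′ , k′≤b , trans shift eq
      where
      shift : pow (suc (b + d)) ≡ pow (suc (a + d))
      shift = begin
        pow (suc (b + d))  ≡⟨ sym (pow-+ b d) ⟩
        pow b ∙ pow d      ≡⟨ cong (_∙ pow d) (sym pa≡pb) ⟩
        pow a ∙ pow d      ≡⟨ pow-+ a d ⟩
        pow (suc (a + d))  ∎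

  ⁺⇔bounded-pow : ∀ x → (⁅ s ⁆ ⁺) x ⇔ (∃[ i ] x ≡ pow (toℕ {suc m} i))
  ⁺⇔bounded-pow x = mk⇔ bounded (λ { (i , refl) → pow∈⁺ (toℕ i) })
    where
    bounded : (⁅ s ⁆ ⁺) x → ∃[ i ] x ≡ pow (toℕ {suc m} i)
    bounded x∈s⁺ =
      let (k , x≡pk) = ⁺⇒pow x∈s⁺
          (a , b , a<b , b≤m , pa≡pb) = repetition
          (k′ , k′≤b , pk≡pk′) = reduce-exponent a<b pa≡pb k
          k′<1+m = s≤s (≤-trans k′≤b b≤m)
      in fromℕ< k′<1+m , trans x≡pk (trans pk≡pk′ (cong pow (sym (toℕ-fromℕ< k′<1+m))))

  ⁺-decidable : Decidable (⁅ s ⁆ ⁺)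
  ⁺-decidable x = Dec.map (⇔.sym (⁺⇔bounded-pow x)) (any? λ i → x ≟ pow (toℕ i))

lemma4p1 : (n : ℕ) (_∙_ : Op₂ (Fin (suc n))) → IsSemigroup _≡_ _∙_ →
           ∀ (s t : Fin (suc n)) →
           Complex._≐_ _∙_ (Complex.Cl _∙_ ⁅ s ⁆) (Complex.Cl _∙_ ⁅ t ⁆)
             ⇔ Complex._≐_ _∙_ (Complex._⁺ _∙_ ⁅ s ⁆) (Complex._⁺ _∙_ ⁅ t ⁆)
lemma4p1 n _∙_ isSemigroup s t = mk⇔ Cl-≐⇒⁺-≐ ⁺-≐⇒Cl-≐
  where
  open Complex _∙_
  open Magma _∙_
  open IsSemigroup isSemigroup using (assoc)

  Cl-≐⇒⁺-≐ : Cl ⁅ s ⁆ ≐ Cl ⁅ t ⁆ → (⁅ s ⁆ ⁺) ≐ (⁅ t ⁆ ⁺)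
  Cl-≐⇒⁺-≐ cl-eq =
    ⁺-≐ (Cl⊆⁺ (Cyclic.⁺-decidable _∙_ assoc s) (from (cl-eq t) (Cl-self t)))
        (Cl⊆⁺ (Cyclic.⁺-decidable _∙_ assoc t) (to (cl-eq s) (Cl-self s)))

  ⁺-≐⇒Cl-≐ : (⁅ s ⁆ ⁺) ≐ (⁅ t ⁆ ⁺) → Cl ⁅ s ⁆ ≐ Cl ⁅ t ⁆
  ⁺-≐⇒Cl-≐ gen-eq = mutual⇒Cl-≐ (from (gen-eq t) (⁺-self t)) (to (gen-eq s) (⁺-self s))
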